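{- Let $H$ be a hypergraph and let $(C,P)$ be a best pair in $H$ with $C = v_1, e_1, \ldots, v_s, e_s, v_1$. For any vertex $u \notin V(C)$ and any $i$, if $u \in e_i$, then $v_i, v_{i+1} \notin N_{H - H_C}(u)$ (indices modulo $s$).
   Context: A hypergraph is a family of distinct subsets (edges) of a vertex set. A Berge cycle of length $s$ is a list $v_1,e_1,\ldots,v_s,e_s,v_1$ of $s$ distinct vertices and $s$ distinct edges with $\{v_i,v_{i+1}\}\subseteq e_i$ (indices mod $s$); a Berge path $u_1,f_1,\ldots,f_{\ell-1},u_\ell$ consists of $\ell$ distinct vertices and $\ell-1$ distinct edges with $\{u_i,u_{i+1}\}\subseteq f_i$ (a single vertex is allowed); $V(\cdot)$, $E(\cdot)$ denote the listed vertices and edges. A pair $(C,P)$ consists of a Berge cycle $C$ and a Berge path $P$ with $V(C)\cap V(P)=\emptyset$ and $E(C)\cap E(P)=\emptyset$. $(C,P)$ is better than $(C',P')$ if, comparing lexicographically in this order, it has larger value of: (i) $|E(C)|$; (ii) $|E(P)|$; (iii) $\sum_{e\in E(C)}|e\cap V(P)|$; (iv) $\sum_{f\in E(P)}|f\cap V(P)|$. A best pair is one such that no pair is better. $H-H_C$ denotes the hypergraph on $V(H)$ with edge set $E(H)\setminus E(C)$. For a hypergraph $F$ and vertex $u$, $N_F(u)=\{v : \{u,v\}\subseteq e \text{ for some } e\in E(F)\}$.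
   Formalization: A Berge path may also be empty, with no vertices and no edges, so a Berge cycle with the empty path counts as a pair when judging best pairs; Berge cycles have length s ≥ 2. Apart from conventions, each condition added here is assumed in the paper as well or is needed for the statement above to hold. -}

module Defs where

open import Data.Nat using (ℕ; zero; suc; _≤_; _<_; pred)
open import Data.Nat.DivMod using (_mod_)
open import Data.Fin using (Fin; toℕ)
open import Data.Fin.Properties using (any?; _≟_)
open import Data.Fin.Subset using (Subset; _∈_; _∩_; ∣_∣)
open import Data.Vec using (tabulate)
open import Data.List using (map; allFin)
open import Data.Nat.ListAction using (sum)
open import Data.Product using (_×_; Σ; ∃)
open import Data.Sum using (_⊎_)
open import Relation.Nullary using (¬_; does)
open import Relation.Binary.PropositionalEquality using (_≡_; _≢_)
open import Function.Definitions using (Injective)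

record Hypergraph (n : ℕ) : Set where
  field
    m        : ℕ
    edge     : Fin m → Subset n
    distinct : Injective _≡_ _≡_ edge

next : ∀ {s} → Fin s → Fin s
next {suc s} i = suc (toℕ i) mod (suc s)

module _ {n : ℕ} (H : Hypergraph n) where
  open Hypergraph H

  record BergeCycle : Set where
    field
      len      : ℕ
      len≥2    : 2 ≤ len
      vtx      : Fin len → Fin n
      edg      : Fin len → Fin m
      vtx-inj  : Injective _≡_ _≡_ vtx
      edg-inj  : Injective _≡_ _≡_ edg
      incident : ∀ i → (vtx i ∈ edge (edg i)) × (vtx (next i) ∈ edge (edg i))

  -- Berge path u₁,f₁,…,f_{ℓ-1},u_ℓ : ℓ vertices and pred ℓ edges
  -- (ℓ = 0, the empty path, is admitted).
  record BergePath : Set where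
    field
      len      : ℕ
      vtx      : Fin len → Fin n
      edg      : Fin (pred len) → Fin m
      vtx-inj  : Injective _≡_ _≡_ vtx
      edg-inj  : Injective _≡_ _≡_ edg
      incident : ∀ (j : Fin (pred len)) (a b : Fin len) →
                 toℕ a ≡ toℕ j → toℕ b ≡ suc (toℕ j) →
                 (vtx a ∈ edge (edg j)) × (vtx b ∈ edge (edg j))

  VP : BergePath → Subset n
  VP P = tabulate λ v → does (any? λ a → BergePath.vtx P a ≟ v)

  record Pair : Set where
    field
      cyc    : BergeCycle
      path   : BergePath
      vdisj  : ∀ i a → BergeCycle.vtx cyc i ≢ BergePath.vtx path a
      edisj  : ∀ i j → BergeCycle.edg cyc i ≢ BergePath.edg path j

  val1 val2 val3 val4 : Pair → ℕ
  val1 X = BergeCycle.len (Pair.cyc X)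
  val2 X = pred (BergePath.len (Pair.path X))
  val3 X = sum (map (λ i → ∣ edge (BergeCycle.edg (Pair.cyc X) i) ∩ VP (Pair.path X) ∣)
                    (allFin (BergeCycle.len (Pair.cyc X))))
  val4 X = sum (map (λ j → ∣ edge (BergePath.edg (Pair.path X) j) ∩ VP (Pair.path X) ∣)
                    (allFin (pred (BergePath.len (Pair.path X)))))

  Lex4< : (ℕ × ℕ × ℕ × ℕ) → (ℕ × ℕ × ℕ × ℕ) → Set
  Lex4< (a1 Data.Product., a2 Data.Product., a3 Data.Product., a4)
        (b1 Data.Product., b2 Data.Product., b3 Data.Product., b4) =
    a1 < b1 ⊎ (a1 ≡ b1 × (a2 < b2 ⊎ (a2 ≡ b2 × (a3 < b3 ⊎ (a3 ≡ b3 × a4 < b4)))))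

  vals : Pair → ℕ × ℕ × ℕ × ℕ
  vals X = val1 X Data.Product., val2 X Data.Product., val3 X Data.Product., val4 X

  Better : Pair → Pair → Set
  Better Y X = Lex4< (vals X) (vals Y)

  Best : Pair → Set
  Best X = ∀ Y → ¬ Better Y X

  InNbrMinusC : BergeCycle → Fin n → Fin n → Set
  InNbrMinusC C u v = Σ (Fin m) λ f →
    (∀ i → BergeCycle.edg C i ≢ f) × (u ∈ edge f) × (v ∈ edge f)

{-# OPTIONS --safe #-}
-- If u ∉ V(C) lies in eᵢ and an edge f ∉ E(C) contains u and vᵢ, then vᵢ, f, u, eᵢ, vᵢ₊₁ is a
-- detour through u that can replace eᵢ (symmetrically vᵢ, eᵢ, u, f, vᵢ₊₁ when f contains vᵢ₊₁).
-- Splicing it in yields a Berge cycle longer than C, and that cycle with the empty path is a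
-- pair better than (C, P).  To splice formally, C is first rotated until i is its last position.
module Submission where

open import Defs
open import Data.Nat using (ℕ; zero; suc; _<_; _%_; s≤s; z≤n)
open import Data.Nat.Properties using (≤-refl; m<n⇒m<1+n)
open import Data.Nat.DivMod using (m<n⇒m%n≡m; n%n≡0)
open import Data.Nat.GeneralisedArithmetic using (iterate; fold; iterate-is-fold)
open import Data.Fin using (Fin; zero; suc; toℕ; fromℕ; inject₁)
open import Data.Fin.Properties
  using (toℕ-injective; toℕ<n; toℕ-fromℕ; toℕ-fromℕ<; toℕ-inject₁; suc-injective; 0≢1+n;
         fromℕ≢inject₁; _≟_)
open import Data.Fin.Relation.Unary.Top using (View; view; ‵fromℕ; ‵inj₁; view-fromℕ; view-inject₁)
open import Data.Fin.Subset using (_∈_)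
open import Data.Vec.Functional using (updateAt)
open import Data.Vec.Functional.Properties using (updateAt-updates; updateAt-minimal)
open import Data.Product using (_×_; _,_; proj₁; proj₂; Σ-syntax; ∃-syntax)
open import Data.Empty using (⊥-elim)
open import Data.Sum using (inj₁)
open import Function using (const; _∘_)
open import Function.Definitions using (Injective)
open import Relation.Nullary using (¬_; yes; no; contradiction)
open import Relation.Binary.PropositionalEquality
  using (_≡_; _≢_; refl; sym; trans; cong; subst; module ≡-Reasoning)
open ≡-Reasoning

toℕ-next : ∀ {n} (k : Fin (suc n)) → toℕ k < n → toℕ (next k) ≡ suc (toℕ k)
toℕ-next k k<n = trans (toℕ-fromℕ< _) (m<n⇒m%n≡m (s≤s k<n))

next-inject₁ : ∀ {n} (j : Fin n) → next (inject₁ j) ≡ suc j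
next-inject₁ j = toℕ-injective (begin
  toℕ (next (inject₁ j))   ≡⟨ toℕ-next (inject₁ j) (subst (_< _) (sym (toℕ-inject₁ j)) (toℕ<n j)) ⟩
  suc (toℕ (inject₁ j))    ≡⟨ cong suc (toℕ-inject₁ j) ⟩
  suc (toℕ j)              ∎)

next-fromℕ : ∀ n → next (fromℕ n) ≡ zero
next-fromℕ n = toℕ-injective (begin
  toℕ (next (fromℕ n))        ≡⟨ toℕ-fromℕ< _ ⟩
  suc (toℕ (fromℕ n)) % suc n ≡⟨ cong (λ m → suc m % suc n) (toℕ-fromℕ n) ⟩
  suc n % suc n               ≡⟨ n%n≡0 (suc n) ⟩
  0                           ∎)

next-injective : ∀ {n} → Injective _≡_ _≡_ (next {n})
next-injective {suc n} {j} {k} eq with view j | view k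
... | ‵fromℕ       | ‵fromℕ       = refl
... | ‵fromℕ       | ‵inj₁ {i = k} _ =
  contradiction (trans (sym (next-fromℕ n)) (trans eq (next-inject₁ k))) 0≢1+n
... | ‵inj₁ {i = j} _ | ‵fromℕ       =
  contradiction (trans (sym (next-fromℕ n)) (trans (sym eq) (next-inject₁ j))) 0≢1+n
... | ‵inj₁ {i = j} _ | ‵inj₁ {i = k} _ =
  cong inject₁ (suc-injective (trans (sym (next-inject₁ j)) (trans eq (next-inject₁ k))))

iterate-comm : ∀ {A : Set} (f : A → A) x r → iterate f (f x) r ≡ f (iterate f x r)
iterate-comm f x r = begin
  iterate f (f x) r   ≡⟨ sym (iterate-is-fold x f (suc r)) ⟩
  f (fold x f r)      ≡⟨ cong f (iterate-is-fold x f r) ⟩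
  f (iterate f x r)   ∎

iterate-injective : ∀ {A : Set} {f : A → A} r → Injective _≡_ _≡_ f →
                    Injective _≡_ _≡_ (λ x → iterate f x r)
iterate-injective zero    f-inj eq = eq
iterate-injective (suc r) f-inj eq = f-inj (iterate-injective r f-inj eq)

toℕ-iterate-next : ∀ {n} t → t < suc n → toℕ (iterate next (zero {n}) t) ≡ t
toℕ-iterate-next zero    _ = refl
toℕ-iterate-next {n} (suc t) (s≤s t<n) = begin
  toℕ (iterate next (next zero) t)   ≡⟨ cong toℕ (iterate-comm next zero t) ⟩
  toℕ (next (iterate next zero t))   ≡⟨ toℕ-next _ (subst (_< n) (sym ih) t<n) ⟩
  suc (toℕ (iterate next zero t))    ≡⟨ cong suc ih ⟩
  suc t                              ∎
  where ih = toℕ-iterate-next t (m<n⇒m<1+n t<n)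

last-reaches : ∀ {s} (i : Fin s) →
               ∃[ ℓ ] suc ℓ ≡ fromℕ s × iterate next ℓ (suc (toℕ i)) ≡ i
last-reaches {suc n} i = fromℕ n , refl , toℕ-injective (begin
  toℕ (iterate next (next (fromℕ n)) (toℕ i)) ≡⟨ cong (λ k → toℕ (iterate next k (toℕ i))) (next-fromℕ n) ⟩
  toℕ (iterate next zero (toℕ i))             ≡⟨ toℕ-iterate-next (toℕ i) (toℕ<n i) ⟩
  toℕ i                                       ∎)

infixl 5 _∷ʳ_

_∷ʳ_ : ∀ {A : Set} {n} → (Fin n → A) → A → Fin (suc n) → A
(f ∷ʳ x) k with view k
... | ‵fromℕ          = x
... | ‵inj₁ {i = j} _ = f j

∷ʳ-fromℕ : ∀ {A : Set} {n} (f : Fin n → A) x → (f ∷ʳ x) (fromℕ n) ≡ x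
∷ʳ-fromℕ {n = n} f x rewrite view-fromℕ n = refl

∷ʳ-inject₁ : ∀ {A : Set} {n} (f : Fin n → A) x j → (f ∷ʳ x) (inject₁ j) ≡ f j
∷ʳ-inject₁ f x j rewrite view-inject₁ j = refl

∷ʳ-injective : ∀ {A : Set} {n} {f : Fin n → A} {x} →
               Injective _≡_ _≡_ f → (∀ j → f j ≢ x) → Injective _≡_ _≡_ (f ∷ʳ x)
∷ʳ-injective {f = f} {x} f-inj x∉f {j} {k} eq with view j | view k
... | ‵fromℕ          | ‵fromℕ          = refl
... | ‵fromℕ          | ‵inj₁ {i = k} _ = contradiction (sym eq) (x∉f k)
... | ‵inj₁ {i = j} _ | ‵fromℕ          = contradiction eq (x∉f j)
... | ‵inj₁ {i = j} _ | ‵inj₁ {i = k} _ = cong inject₁ (f-inj eq)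

updateAt-const-injective : ∀ {A : Set} {n} {f : Fin n → A} {i x} → Injective _≡_ _≡_ f →
                           (∀ j → f j ≡ x → j ≡ i) → Injective _≡_ _≡_ (updateAt f i (const x))
updateAt-const-injective {f = f} {i} {x} f-inj x-only-at-i {j} {k} eq with j ≟ i | k ≟ i
... | yes refl | yes refl = refl
... | yes refl | no k≢i   = contradiction (x-only-at-i k (begin
  f k                      ≡⟨ updateAt-minimal k i f k≢i ⟨
  updateAt f i (const x) k ≡⟨ eq ⟨
  updateAt f i (const x) i ≡⟨ updateAt-updates i f ⟩
  x                        ∎)) k≢i
... | no j≢i   | yes refl = contradiction (x-only-at-i j (begin
  f j                      ≡⟨ updateAt-minimal j i f j≢i ⟨
  updateAt f i (const x) j ≡⟨ eq ⟩
  updateAt f i (const x) i ≡⟨ updateAt-updates i f ⟩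
  x                        ∎)) j≢i
... | no j≢i   | no k≢i   = f-inj (begin
  f j                      ≡⟨ updateAt-minimal j i f j≢i ⟨
  updateAt f i (const x) j ≡⟨ eq ⟩
  updateAt f i (const x) k ≡⟨ updateAt-minimal k i f k≢i ⟩
  f k                      ∎)

module _ {n} {H : Hypergraph n} where
  open Hypergraph H
  open BergeCycle

  rotate : BergeCycle H → ℕ → BergeCycle H
  rotate C r = record
    { len      = len C
    ; len≥2    = len≥2 C
    ; vtx      = vtx C ∘ σ
    ; edg      = edg C ∘ σ
    ; vtx-inj  = iterate-injective r next-injective ∘ vtx-inj C
    ; edg-inj  = iterate-injective r next-injective ∘ edg-inj C
    ; incident = λ k → let (vₖ∈eₖ , vₖ₊₁∈eₖ) = incident C (σ k) in
        vₖ∈eₖ , subst (λ j → vtx C j ∈ edge (edg C (σ k))) (sym (iterate-comm next k r)) vₖ₊₁∈eₖ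
    }
    where σ = λ k → iterate next k r

  record Detour (C : BergeCycle H) (i : Fin (len C)) (u : Fin n) : Set where
    field
      u∉C     : ∀ k → vtx C k ≢ u
      a b     : Fin m
      vᵢ∈a    : vtx C i ∈ edge a
      u∈a     : u ∈ edge a
      u∈b     : u ∈ edge b
      vᵢ₊₁∈b  : vtx C (next i) ∈ edge b
      a≢b     : a ≢ b
      a-fresh : ∀ k → edg C k ≡ a → k ≡ i
      b-fresh : ∀ k → edg C k ≡ b → k ≡ i

  detour-rotate : ∀ {C ℓ u} r → Detour C (iterate next ℓ r) u → Detour (rotate C r) ℓ u
  detour-rotate {C} {ℓ} r d = record
    { u∉C     = u∉C ∘ σ
    ; a       = a
    ; b       = b
    ; vᵢ∈a    = vᵢ∈a
    ; u∈a     = u∈a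
    ; u∈b     = u∈b
    ; vᵢ₊₁∈b  = subst (λ j → vtx C j ∈ edge b) (sym (iterate-comm next ℓ r)) vᵢ₊₁∈b
    ; a≢b     = a≢b
    ; a-fresh = λ k eq → iterate-injective r next-injective (a-fresh (σ k) eq)
    ; b-fresh = λ k eq → iterate-injective r next-injective (b-fresh (σ k) eq)
    }
    where open Detour d
          σ = λ k → iterate next k r

  extend-at-last : ∀ {u} (C : BergeCycle H) (ℓ : Fin (len C)) → suc ℓ ≡ fromℕ (len C) →
                   Detour C ℓ u → Σ[ C' ∈ BergeCycle H ] len C < len C'
  extend-at-last {u} C@record { len = suc L } .(fromℕ L) refl d = C' , ≤-refl
    where
    open Detour d
    v = vtx C
    e = edg C
    -- C' is v₀, e₀, …, v_L, a, u, b, v₀: the last edge e_L gives way to the detour through u.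
    e' = updateAt e (fromℕ L) (const a)

    b∉e' : ∀ j → e' j ≢ b
    b∉e' j with j ≟ fromℕ L
    ... | yes refl = λ a≡b → a≢b (trans (sym (updateAt-updates (fromℕ L) e)) a≡b)
    ... | no j≢ℓ   = λ e'ⱼ≡b → j≢ℓ (b-fresh j (trans (sym (updateAt-minimal j (fromℕ L) e j≢ℓ)) e'ⱼ≡b))

    incident-C' : ∀ k → ((v ∷ʳ u) k ∈ edge ((e' ∷ʳ b) k))
                    × ((v ∷ʳ u) (next k) ∈ edge ((e' ∷ʳ b) k))
    incident-C' k with view k
    ... | ‵fromℕ = u∈b , subst (_∈ edge b) (cong (v ∷ʳ u) (sym (next-fromℕ (suc L))))
                           (subst (λ j → v j ∈ edge b) (next-fromℕ L) vᵢ₊₁∈b)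
    ... | ‵inj₁ {i = j} _ rewrite next-inject₁ j = incident-inject₁ (view j)
      where
      incident-inject₁ : ∀ {j} → View j → (v j ∈ edge (e' j)) × ((v ∷ʳ u) (suc j) ∈ edge (e' j))
      incident-inject₁ ‵fromℕ =
        subst (λ f → v (fromℕ L) ∈ edge f × (v ∷ʳ u) (fromℕ (suc L)) ∈ edge f)
              (sym (updateAt-updates (fromℕ L) e))
              (vᵢ∈a , subst (_∈ edge a) (sym (∷ʳ-fromℕ v u)) u∈a)
      incident-inject₁ (‵inj₁ {i = j} _) =
        subst (λ f → v (inject₁ j) ∈ edge f × (v ∷ʳ u) (inject₁ (suc j)) ∈ edge f)
              (sym (updateAt-minimal (inject₁ j) (fromℕ L) e (fromℕ≢inject₁ ∘ sym)))
              (vⱼ∈eⱼ , subst (_∈ edge (e (inject₁ j))) (sym (∷ʳ-inject₁ v u (suc j)))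
                         (subst (λ k → v k ∈ edge (e (inject₁ j))) (next-inject₁ j) vⱼ₊₁∈eⱼ))
        where vⱼ∈eⱼ = proj₁ (incident C (inject₁ j)) ; vⱼ₊₁∈eⱼ = proj₂ (incident C (inject₁ j))

    C' : BergeCycle H
    C' = record
      { len      = suc (suc L)
      ; len≥2    = s≤s (s≤s z≤n)
      ; vtx      = v ∷ʳ u
      ; edg      = e' ∷ʳ b
      ; vtx-inj  = ∷ʳ-injective (vtx-inj C) u∉C
      ; edg-inj  = ∷ʳ-injective (updateAt-const-injective (edg-inj C) a-fresh) b∉e'
      ; incident = incident-C'
      }

  detour⇒longer-cycle : ∀ {C i u} → Detour C i u → Σ[ C' ∈ BergeCycle H ] len C < len C'
  detour⇒longer-cycle {C} {i} {u} d with last-reaches i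
  ... | ℓ , ℓ-last , σℓ≡i = extend-at-last (rotate C r) ℓ ℓ-last
                              (detour-rotate r (subst (λ j → Detour C j u) (sym σℓ≡i) d))
    where r = suc (toℕ i)

  emptyPath : BergePath H
  emptyPath = record
    { len = 0 ; vtx = λ () ; edg = λ () ; vtx-inj = λ { {()} } ; edg-inj = λ { {()} } ; incident = λ () }

  best⇒longest-cycle : (X : Pair H) → Best H X → (C : BergeCycle H) → ¬ len (Pair.cyc X) < len C
  best⇒longest-cycle _ best C longer =
    best (record { cyc = C ; path = emptyPath ; vdisj = λ _ () ; edisj = λ _ () }) (inj₁ longer)

claim3p2 : ∀ {n : ℕ} (H : Hypergraph n) (X : Pair H) → Best H X →
  let C = Pair.cyc X in
  ∀ (u : Fin n) → (∀ j → BergeCycle.vtx C j ≢ u) →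
  ∀ (i : Fin (BergeCycle.len C)) →
  u ∈ Hypergraph.edge H (BergeCycle.edg C i) →
  (¬ InNbrMinusC H C u (BergeCycle.vtx C i))
    × (¬ InNbrMinusC H C u (BergeCycle.vtx C (next i)))
claim3p2 H X best u u∉C i u∈eᵢ = vᵢ∉N , vᵢ₊₁∉N
  where
  C = Pair.cyc X
  open BergeCycle C

  no-detour : ∀ {j} → ¬ Detour C j u
  no-detour d = let (C' , longer) = detour⇒longer-cycle d in best⇒longest-cycle X best C' longer

  vᵢ∉N : ¬ InNbrMinusC H C u (vtx i)
  vᵢ∉N (f , f∉C , u∈f , vᵢ∈f) = no-detour (record
    { u∉C = u∉C ; a = f ; b = edg i ; vᵢ∈a = vᵢ∈f ; u∈a = u∈f ; u∈b = u∈eᵢ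
    ; vᵢ₊₁∈b = proj₂ (incident i) ; a≢b = f∉C i ∘ sym
    ; a-fresh = λ k eq → ⊥-elim (f∉C k eq) ; b-fresh = λ _ → edg-inj })

  vᵢ₊₁∉N : ¬ InNbrMinusC H C u (vtx (next i))
  vᵢ₊₁∉N (f , f∉C , u∈f , vᵢ₊₁∈f) = no-detour (record
    { u∉C = u∉C ; a = edg i ; b = f ; vᵢ∈a = proj₁ (incident i) ; u∈a = u∈eᵢ ; u∈b = u∈f
    ; vᵢ₊₁∈b = vᵢ₊₁∈f ; a≢b = f∉C i
    ; a-fresh = λ _ → edg-inj ; b-fresh = λ k eq → ⊥-elim (f∉C k eq) })
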